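{- Let $\alpha$ be a rational number with $\alpha\neq\pm1$ and such that $(3\alpha^4-6\alpha^2-1)(\alpha^4+6\alpha^2-3)\neq0$. Put $r=-\frac{\alpha^4+6\alpha^2-3}{3\alpha^4-6\alpha^2-1}$, $s=r\alpha$, and $$a=\frac{(\alpha^4+6\alpha^2-3)^2(\alpha+1)(\alpha-1)}{(3\alpha^4-6\alpha^2-1)^2},$$ $$b=\frac{ -16(5\alpha^4-2\alpha^2+1)(\alpha^4-2\alpha^2+5)(\alpha^2+2\alpha-1)(\alpha^2-2\alpha-1)(\alpha^2+1)}{(3\alpha^4-6\alpha^2-1)^2(\alpha^4+6\alpha^2-3)^2},$$ $$c=\frac{\left((\alpha^2+1)^4+16\alpha^2(\alpha^2-1)^2\right)\left((\alpha-1)^4+4\alpha^2\right)\left((\alpha+1)^4+4\alpha^2\right)(\alpha^2+1)}{(3\alpha^4-6\alpha^2-1)^2(\alpha^4+6\alpha^2-3)^2}.$$ Then $a=s^2-r^2$, $b=\frac{r^4-1}{a}$, $c=\frac{s^4-1}{a}$, and $(a,b,c)$ is a quartic Diophantine triple.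
   Context: A quartic Diophantine triple is a triple $(a,b,c)$ of distinct nonzero rational numbers such that $ab+1$, $ac+1$ and $bc+1$ are all fourth powers of rational numbers. -}

module Defs where

open import Data.Nat using (ℕ; zero; suc)
open import Data.Integer using (+_)
open import Data.Rational using (ℚ; 0ℚ; 1ℚ; _*_; _+_; _-_; -_; _÷_; ≢-nonZero)
  renaming (_/_ to _//_)
open import Data.Rational.Properties using (_≟_)
open import Data.Product using (Σ; _×_)
open import Relation.Binary.PropositionalEquality using (_≡_; _≢_)
open import Relation.Nullary using (yes; no)

infixr 8 _^_
_^_ : ℚ → ℕ → ℚ
x ^ zero  = 1ℚ
x ^ suc n = x * (x ^ n)

k : ℕ → ℚ
k n = (+ n) // 1

infixl 7 _⁄_
-- total division on ℚ: x ⁄ y = x / y when y ≠ 0, and 0 when y = 0.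
-- (In the theorem, every divisor used is nonzero, either by hypothesis
-- or because the conclusion asserts it.)
_⁄_ : ℚ → ℚ → ℚ
x ⁄ y with y ≟ 0ℚ
... | yes _ = 0ℚ
... | no y≢0 = _÷_ x y {{≢-nonZero y≢0}}

IsFourthPower : ℚ → Set
IsFourthPower q = Σ ℚ (λ t → q ≡ t ^ 4)

QuarticDiophantineTriple : ℚ → ℚ → ℚ → Set
QuarticDiophantineTriple a b c =
  (a ≢ 0ℚ) × (b ≢ 0ℚ) × (c ≢ 0ℚ) ×
  (a ≢ b) × (a ≢ c) × (b ≢ c) ×
  IsFourthPower (a * b + 1ℚ) × IsFourthPower (a * c + 1ℚ) × IsFourthPower (b * c + 1ℚ)

{-# OPTIONS --safe #-}
-- Then a = s² - r², ab + 1 = r⁴ and ac + 1 = s⁴, and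
-- bc + 1 = (Q/(D₁D₂))⁴ for Q = α⁸ - 28α⁶ + 6α⁴ - 28α² + 1. Treating u = 1/D₁ and v = 1/D₂
-- as variables subject to D₁u = D₂v = 1, each of these follows from a polynomial identity
-- in α alone. After clearing the denominator D₁²D₂², a ≠ 0 needs only α ≠ ±1, while the
-- numerators of b, c and of the pairwise differences of a, b, c are products of integer
-- polynomials in α without rational roots: a root n/d in lowest terms would have n dividing
-- the constant and d the leading coefficient, which leaves finitely many fractions to test.
module Submission where

open import Algebra.Bundles using (CommutativeMonoid)
open import Algebra.Bundles.Raw using (RawRing)
open import Data.Empty using (⊥-elim)
open import Data.Fin as Fin using (Fin; toℕ; fromℕ<)
open import Data.Fin.Properties using (all?; toℕ-fromℕ<)
open import Data.Integer as ℤ using (ℤ; +_; -[1+_]; ∣_∣; 0ℤ; 1ℤ)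
open import Data.Integer.Coprimality using (Coprime; coprime-divisor)
import Data.Integer.Coprimality as Coprimeℤ
open import Data.Integer.Divisibility using (_∣_)
import Data.Integer.Divisibility.Signed as Signed
import Data.Integer.Properties as ℤ
open import Data.Integer.Tactic.RingSolver using (solve-∀)
open import Data.List using (List; []; _∷_; _∷ʳ_; length)
import Data.List.Properties as List
import Data.Maybe as Maybe
open import Data.Nat as ℕ using (ℕ; zero; suc; s≤s)
import Data.Nat.Coprimality as Coprimality
import Data.Nat.Divisibility as ℕ
import Data.Nat.Properties as ℕ
open import Data.Product using (_×_; _,_; proj₁; proj₂)
open import Data.Rational as ℚ using (mkℚ; ↥_; ↧_; 1/_; ≢-nonZero)
import Data.Rational.Properties as ℚ
import Data.Rational.Unnormalised.Base as ℚᵘ using (*≡*)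
import Data.Rational.Unnormalised.Properties as ℚᵘ
open import Data.Vec using ([]; _∷_)
open import Level using (0ℓ)
open import Relation.Binary.PropositionalEquality
  using (_≡_; _≢_; refl; sym; trans; cong; cong₂; subst; subst₂; module ≡-Reasoning)
open import Relation.Nullary.Decidable
  using (Dec; yes; no; True; False; toWitness; toWitnessFalse; ¬?; _×-dec_; dec⇒maybe)
open import Tactic.RingSolver.Core.AlmostCommutativeRing
  using (AlmostCommutativeRing; fromCommutativeRing)

-- Coefficient lists start with the constant term, and homogenise P n d = d ^ deg P * P (n / d).
homogenise : List ℤ → ℤ → ℤ → ℤ
homogenise []       n d = 0ℤ
homogenise (c ∷ cs) n d = c ℤ.* d ℤ.^ length cs ℤ.+ n ℤ.* homogenise cs n d

homogenise-∷ʳ : ∀ cs l n d →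
  homogenise (cs ∷ʳ l) n d ≡ d ℤ.* homogenise cs n d ℤ.+ l ℤ.* n ℤ.^ length cs
homogenise-∷ʳ []       l n d = singleton l n d
  where
  singleton : ∀ l n d → l ℤ.* 1ℤ ℤ.+ n ℤ.* 0ℤ ≡ d ℤ.* 0ℤ ℤ.+ l ℤ.* 1ℤ
  singleton = solve-∀
homogenise-∷ʳ (c ∷ cs) l n d = begin
  c ℤ.* d ℤ.^ length (cs ∷ʳ l) ℤ.+ n ℤ.* homogenise (cs ∷ʳ l) n d
    ≡⟨ cong₂ (λ m h → c ℤ.* d ℤ.^ m ℤ.+ n ℤ.* h) length-∷ʳ (homogenise-∷ʳ cs l n d) ⟩
  c ℤ.* (d ℤ.* d ℤ.^ m) ℤ.+ n ℤ.* (d ℤ.* H ℤ.+ l ℤ.* n ℤ.^ m)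
    ≡⟨ regroup c d (d ℤ.^ m) n H l (n ℤ.^ m) ⟩
  d ℤ.* (c ℤ.* d ℤ.^ m ℤ.+ n ℤ.* H) ℤ.+ l ℤ.* (n ℤ.* n ℤ.^ m) ∎
  where
  open ≡-Reasoning
  m : ℕ
  m = length cs
  H : ℤ
  H = homogenise cs n d
  length-∷ʳ : length (cs ∷ʳ l) ≡ suc m
  length-∷ʳ = trans (List.length-++ cs) (ℕ.+-comm m 1)
  regroup : ∀ c d dᵐ n h l nᵐ →
    c ℤ.* (d ℤ.* dᵐ) ℤ.+ n ℤ.* (d ℤ.* h ℤ.+ l ℤ.* nᵐ)
      ≡ d ℤ.* (c ℤ.* dᵐ ℤ.+ n ℤ.* h) ℤ.+ l ℤ.* (n ℤ.* nᵐ)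
  regroup = solve-∀

x+i*h≡0⇒i∣x : ∀ x i h → x ℤ.+ i ℤ.* h ≡ 0ℤ → i ∣ x
x+i*h≡0⇒i∣x x i h x+ih≡0 = Signed.∣⇒∣ᵤ (Signed.divides (ℤ.- h) (begin
  x                                   ≡⟨ split x i h ⟩
  (x ℤ.+ i ℤ.* h) ℤ.+ ℤ.- h ℤ.* i     ≡⟨ cong (ℤ._+ ℤ.- h ℤ.* i) x+ih≡0 ⟩
  0ℤ ℤ.+ ℤ.- h ℤ.* i                  ≡⟨ ℤ.+-identityˡ (ℤ.- h ℤ.* i) ⟩
  ℤ.- h ℤ.* i                         ∎))
  where
  open ≡-Reasoning
  split : ∀ x i h → x ≡ (x ℤ.+ i ℤ.* h) ℤ.+ ℤ.- h ℤ.* i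
  split = solve-∀

coprime-∣-*-^ : ∀ i j c m → Coprime i j → i ∣ c ℤ.* j ℤ.^ m → i ∣ c
coprime-∣-*-^ i j c zero    i⊥j i∣c*1 = subst (i ∣_) (ℤ.*-identityʳ c) i∣c*1
coprime-∣-*-^ i j c (suc m) i⊥j i∣c*jʲ⁺¹ =
  coprime-∣-*-^ i j c m i⊥j (coprime-divisor i j (c ℤ.* j ℤ.^ m) i⊥j
    (subst (i ∣_) (x∙yz≈y∙xz c j (j ℤ.^ m)) i∣c*jʲ⁺¹))
  where
  open import Algebra.Properties.CommutativeSemigroup ℤ.*-commutativeSemigroup using (x∙yz≈y∙xz)

rational-root-theorem : ∀ {n d} c cs l → Coprime n d →
  homogenise (c ∷ (cs ∷ʳ l)) n d ≡ 0ℤ → (n ∣ c) × (d ∣ l)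
rational-root-theorem {n} {d} c cs l n⊥d H≡0 = n∣c , d∣l
  where
  n∣c : n ∣ c
  n∣c = coprime-∣-*-^ n d c (length (cs ∷ʳ l)) n⊥d
    (x+i*h≡0⇒i∣x (c ℤ.* d ℤ.^ length (cs ∷ʳ l)) n (homogenise (cs ∷ʳ l) n d) H≡0)
  lead : l ℤ.* n ℤ.^ length (c ∷ cs) ℤ.+ d ℤ.* homogenise (c ∷ cs) n d ≡ 0ℤ
  lead = trans (ℤ.+-comm (l ℤ.* n ℤ.^ length (c ∷ cs)) (d ℤ.* homogenise (c ∷ cs) n d))
    (trans (sym (homogenise-∷ʳ (c ∷ cs) l n d)) H≡0)
  d∣l : d ∣ l
  d∣l = coprime-∣-*-^ d n l (length (c ∷ cs)) (Coprimeℤ.sym {n} {d} n⊥d)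
    (x+i*h≡0⇒i∣x (l ℤ.* n ℤ.^ length (c ∷ cs)) d (homogenise (c ∷ cs) n d) lead)

NonzeroOnFractions : List ℤ → ℕ → ℕ → Set
NonzeroOnFractions P B D = ∀ (m : Fin (suc B)) (e : Fin D) →
  homogenise P (+ toℕ m) (+ suc (toℕ e)) ≢ 0ℤ × homogenise P (ℤ.- (+ toℕ m)) (+ suc (toℕ e)) ≢ 0ℤ

nonzeroOnFractions? : ∀ P B D → Dec (NonzeroOnFractions P B D)
nonzeroOnFractions? P B D = all? λ m → all? λ e →
  ¬? (homogenise P (+ toℕ m) (+ suc (toℕ e)) ℤ.≟ 0ℤ)
    ×-dec ¬? (homogenise P (ℤ.- (+ toℕ m)) (+ suc (toℕ e)) ℤ.≟ 0ℤ)

nonzero-at : ∀ {P B D} → NonzeroOnFractions P B D →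
  ∀ n dm → ∣ n ∣ ℕ.≤ B → dm ℕ.< D → homogenise P n (+ suc dm) ≢ 0ℤ
nonzero-at {P} nonzero (+ m) dm m≤B dm<D =
  subst₂ (λ i j → homogenise P (+ i) (+ suc j) ≢ 0ℤ) (toℕ-fromℕ< (s≤s m≤B)) (toℕ-fromℕ< dm<D)
    (proj₁ (nonzero (fromℕ< (s≤s m≤B)) (fromℕ< dm<D)))
nonzero-at {P} nonzero -[1+ m ] dm m<B dm<D =
  subst₂ (λ i j → homogenise P (ℤ.- (+ i)) (+ suc j) ≢ 0ℤ) (toℕ-fromℕ< (s≤s m<B)) (toℕ-fromℕ< dm<D)
    (proj₂ (nonzero (fromℕ< (s≤s m<B)) (fromℕ< dm<D)))

-- Written over an arbitrary raw ring, so that the same terms are evaluated in ℚ, where they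
-- unfold to the expressions of the statement, and reified as ring-solver expressions.
module Polynomials (R : RawRing 0ℓ 0ℓ) (fromℤ : ℤ → RawRing.Carrier R) where
  open RawRing R
  open import Algebra.Definitions.RawSemiring rawSemiring public using (_^_)

  infixl 6 _-_
  _-_ : Carrier → Carrier → Carrier
  x - y = x + - y

  eval : List ℤ → Carrier → Carrier
  eval []       x = 0#
  eval (c ∷ cs) x = fromℤ c + x * eval cs x

  k : ℕ → Carrier
  k n = fromℤ (+ n)

  D₁ D₂ Na f₁ f₂ f₃ f₄ f₅ Nb Nc Q : Carrier → Carrier
  D₁ α = k 3 * α ^ 4 - k 6 * α ^ 2 - 1#
  D₂ α = α ^ 4 + k 6 * α ^ 2 - k 3
  Na α = (D₂ α ^ 2) * (α + 1#) * (α - 1#)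
  f₁ α = k 5 * α ^ 4 - k 2 * α ^ 2 + 1#
  f₂ α = α ^ 4 - k 2 * α ^ 2 + k 5
  f₃ α = α ^ 2 + k 2 * α - 1#
  f₄ α = α ^ 2 - k 2 * α - 1#
  f₅ α = α ^ 2 + 1#
  Nb α = - k 16 * f₁ α * f₂ α * f₃ α * f₄ α * f₅ α
  Nc α = ((α ^ 2 + 1#) ^ 4 + k 16 * α ^ 2 * (α ^ 2 - 1#) ^ 2)
           * ((α - 1#) ^ 4 + k 4 * α ^ 2) * ((α + 1#) ^ 4 + k 4 * α ^ 2) * (α ^ 2 + 1#)
  Q α = α ^ 8 - k 28 * α ^ 6 + k 6 * α ^ 4 - k 28 * α ^ 2 + 1#

-- Opened only now: inside Polynomials the operator names denote the operations of R.
open import Defs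
open import Data.Rational using (ℚ; 0ℚ; 1ℚ; _*_; _+_; _-_; -_)

ι : ℤ → ℚ
ι i = mkℚ i 0 (Coprimality.sym (Coprimality.1-coprimeTo ∣ i ∣))

open Polynomials ℚ.+-*-rawRing ι using (eval; D₁; D₂; Na; f₁; f₂; f₃; f₄; f₅; Nb; Nc; Q)

ι-+ : ∀ i j → ι (i ℤ.+ j) ≡ ι i + ι j
ι-+ i j = trans (sym (ℚ.↥p/↧p≡p (ι (i ℤ.+ j))))
  (cong (ℚ._/ 1) (cong₂ ℤ._+_ (sym (ℤ.*-identityʳ i)) (sym (ℤ.*-identityʳ j))))

ι-* : ∀ i j → ι (i ℤ.* j) ≡ ι i * ι j
ι-* i j = sym (ℚ.↥p/↧p≡p (ι (i ℤ.* j)))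

ι-^ : ∀ i m → ι (i ℤ.^ m) ≡ ι i ^ m
ι-^ i zero    = refl
ι-^ i (suc m) = trans (ι-* i (i ℤ.^ m)) (cong (ι i *_) (ι-^ i m))

x*↧x≡↥x : ∀ x → x * ι (↧ x) ≡ ι (↥ x)
x*↧x≡↥x x@(mkℚ n dm _) =
  ℚ.toℚᵘ-injective (ℚᵘ.≃-trans (ℚ.toℚᵘ-homo-* x (ι (↧ x))) (ℚᵘ.*≡* cross))
  where
  cross : n ℤ.* + suc dm ℤ.* 1ℤ ≡ n ℤ.* + suc (dm ℕ.* 1)
  cross rewrite ℕ.*-identityʳ dm = ℤ.*-identityʳ (n ℤ.* + suc dm)

ℚ-ring : AlmostCommutativeRing 0ℓ 0ℓ
ℚ-ring = fromCommutativeRing ℚ.+-*-commutativeRing isZero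
  where
  isZero : ∀ x → Maybe.Maybe (0ℚ ≡ x)
  isZero x = Maybe.map sym (dec⇒maybe (x ℚ.≟ 0ℚ))

open import Tactic.RingSolver.NonReflective ℚ-ring
  using (Expr; Κ; Ι; _⊕_; _⊗_; ⊝_; solve; _⊜_; module Ops)

exprRawRing : ℕ → RawRing 0ℓ 0ℓ
exprRawRing n = record
  { Carrier = Expr ℚ n
  ; _≈_     = _≡_
  ; _+_     = _⊕_
  ; _*_     = _⊗_
  ; -_      = ⊝_
  ; 0#      = Κ 0ℚ
  ; 1#      = Κ 1ℚ
  }

constant : ∀ {n} → ℤ → Expr ℚ n
constant i = Κ (ι i)

module Reified {n : ℕ} = Polynomials (exprRawRing n) constant
open Reified using () renaming (_-_ to infixl 6 _⊖_; _^_ to infixr 8 _⊙_)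

x*y≡1⇒x≢0 : ∀ {x y} → x * y ≡ 1ℚ → x ≢ 0ℚ
x*y≡1⇒x≢0 {x} {y} xy≡1 x≡0 = ℚ.1≢0 (trans (sym xy≡1) (trans (cong (_* y) x≡0) (ℚ.*-zeroˡ y)))

inverse-* : ∀ {x y x′ y′} → x * y ≡ 1ℚ → x′ * y′ ≡ 1ℚ → (x * x′) * (y * y′) ≡ 1ℚ
inverse-* {x} {y} {x′} {y′} xy≡1 x′y′≡1 = trans (interchange x x′ y y′) (cong₂ _*_ xy≡1 x′y′≡1)
  where
  open import Algebra.Properties.CommutativeSemigroup
    (CommutativeMonoid.commutativeSemigroup ℚ.*-1-commutativeMonoid) using (interchange)

inverse-^ : ∀ n {x y} → x * y ≡ 1ℚ → x ^ n * y ^ n ≡ 1ℚ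
inverse-^ zero    xy≡1 = refl
inverse-^ (suc n) {x} {y} xy≡1 = inverse-* {x} {y} {x ^ n} {y ^ n} xy≡1 (inverse-^ n xy≡1)

module _ {z : ℚ} (z≢0 : z ≢ 0ℚ) where
  private instance
    z-nonZero : ℚ.NonZero z
    z-nonZero = ≢-nonZero z≢0

  x*z*1/z≡x : ∀ x → x * z * 1/ z ≡ x
  x*z*1/z≡x x =
    trans (ℚ.*-assoc x z (1/ z)) (trans (cong (x *_) (ℚ.*-inverseʳ z)) (ℚ.*-identityʳ x))

  *-cancelʳ-≡ : ∀ {x y} → x * z ≡ y * z → x ≡ y
  *-cancelʳ-≡ {x} {y} xz≡yz =
    trans (sym (x*z*1/z≡x x)) (trans (cong (_* 1/ z) xz≡yz) (x*z*1/z≡x y))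

  x⁄z≡x*1/z : ∀ x → x ⁄ z ≡ x * 1/ z
  x⁄z≡x*1/z x with z ℚ.≟ 0ℚ
  ... | yes z≡0 = ⊥-elim (z≢0 z≡0)
  ... | no _    = refl

  x⁄z*z≡x : ∀ x → x ⁄ z * z ≡ x
  x⁄z*z≡x x = trans (cong (_* z) (x⁄z≡x*1/z x))
    (trans (ℚ.*-assoc x (1/ z) z) (trans (cong (x *_) (ℚ.*-inverseˡ z)) (ℚ.*-identityʳ x)))

  x≡y*z⇒x⁄z≡y : ∀ {x y} → x ≡ y * z → x ⁄ z ≡ y
  x≡y*z⇒x⁄z≡y {x} {y} x≡yz =
    trans (x⁄z≡x*1/z x) (trans (cong (_* 1/ z) x≡yz) (x*z*1/z≡x y))

*-≢0 : ∀ {x y} → x ≢ 0ℚ → y ≢ 0ℚ → x * y ≢ 0ℚ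
*-≢0 {x} {y} x≢0 y≢0 xy≡0 = x≢0 (*-cancelʳ-≡ y≢0 (trans xy≡0 (sym (ℚ.*-zeroˡ y))))

y*w≡1⇒x⁄y≡x*w : ∀ {x y w} → y * w ≡ 1ℚ → x ⁄ y ≡ x * w
y*w≡1⇒x⁄y≡x*w {x} {y} {w} yw≡1 = trans (x⁄z≡x*1/z y≢0 x) (cong (x *_) 1/y≡w)
  where
  y≢0 : y ≢ 0ℚ
  y≢0 = x*y≡1⇒x≢0 yw≡1
  instance
    y-nonZero : ℚ.NonZero y
    y-nonZero = ≢-nonZero y≢0
  1/y≡w : 1/ y ≡ w
  1/y≡w = *-cancelʳ-≡ y≢0 (trans (ℚ.*-inverseˡ y) (trans (sym yw≡1) (ℚ.*-comm y w)))

x-y≢0⇒x≢y : ∀ {x y} → x - y ≢ 0ℚ → x ≢ y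
x-y≢0⇒x≢y x-y≢0 x≡y = x-y≢0 (x≈y⇒x∙y⁻¹≈ε x≡y)
  where open import Algebra.Properties.Group ℚ.+-0-group using (x≈y⇒x∙y⁻¹≈ε)

x≡y-1⇒x+1≡y : ∀ {x y} → x ≡ y - 1ℚ → x + 1ℚ ≡ y
x≡y-1⇒x+1≡y {x} {y} x≡y-1 = trans (cong (_+ 1ℚ) x≡y-1) (y-1+1≡y y)
  where
  y-1+1≡y : ∀ y → y - 1ℚ + 1ℚ ≡ y
  y-1+1≡y = solve 1 (λ y → (y ⊖ Κ 1ℚ ⊕ Κ 1ℚ) ⊜ y) refl

eval-homogenise : ∀ x cs →
  eval cs x * ι (↧ x) ^ length cs ≡ ι (homogenise cs (↥ x) (↧ x)) * ι (↧ x)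
eval-homogenise x []       = sym (ℚ.*-zeroˡ (ι (↧ x)))
eval-homogenise x (c ∷ cs) = begin
  (ι c + x * E) * (D * D ^ m)                  ≡⟨ expand (ι c) x E D (D ^ m) ⟩
  ι c * (D * D ^ m) + (x * D) * (E * D ^ m)    ≡⟨ cong₂ (λ p q → ι c * (D * D ^ m) + p * q)
                                                    (x*↧x≡↥x x) (eval-homogenise x cs) ⟩
  ι c * (D * D ^ m) + ι n * (ι H * D)          ≡⟨ collect (ι c) (D ^ m) (ι n) (ι H) D ⟩
  (ι c * D ^ m + ι n * ι H) * D                ≡⟨ cong (_* D) (sym ι-step) ⟩
  ι (c ℤ.* d ℤ.^ m ℤ.+ n ℤ.* H) * D            ∎
  where
  open ≡-Reasoning
  n d : ℤ
  n = ↥ x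
  d = ↧ x
  D E : ℚ
  D = ι d
  E = eval cs x
  m : ℕ
  m = length cs
  H : ℤ
  H = homogenise cs n d
  expand : ∀ c x e d dᵐ → (c + x * e) * (d * dᵐ) ≡ c * (d * dᵐ) + (x * d) * (e * dᵐ)
  expand = solve 5 (λ c x e d dᵐ →
    (c ⊕ x ⊗ e) ⊗ (d ⊗ dᵐ) ⊜ (c ⊗ (d ⊗ dᵐ) ⊕ (x ⊗ d) ⊗ (e ⊗ dᵐ))) refl
  collect : ∀ c dᵐ n h d → c * (d * dᵐ) + n * (h * d) ≡ (c * dᵐ + n * h) * d
  collect = solve 5 (λ c dᵐ n h d →
    (c ⊗ (d ⊗ dᵐ) ⊕ n ⊗ (h ⊗ d)) ⊜ (c ⊗ dᵐ ⊕ n ⊗ h) ⊗ d) refl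
  ι-step : ι (c ℤ.* d ℤ.^ m ℤ.+ n ℤ.* H) ≡ ι c * D ^ m + ι n * ι H
  ι-step = trans (ι-+ (c ℤ.* d ℤ.^ m) (n ℤ.* H))
    (cong₂ _+_ (trans (ι-* c (d ℤ.^ m)) (cong (ι c *_) (ι-^ d m))) (ι-* n H))

root⇒homogenise≡0 : ∀ cs x → eval cs x ≡ 0ℚ → homogenise cs (↥ x) (↧ x) ≡ 0ℤ
root⇒homogenise≡0 cs x@record{} root = cong ↥_ (*-cancelʳ-≡ D≢0 {ι H} {0ℚ} (begin
  ι H * D                    ≡⟨ eval-homogenise x cs ⟨
  eval cs x * D ^ length cs  ≡⟨ cong (_* D ^ length cs) root ⟩
  0ℚ * D ^ length cs         ≡⟨ ℚ.*-zeroˡ (D ^ length cs) ⟩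
  0ℚ                         ≡⟨ ℚ.*-zeroˡ D ⟨
  0ℚ * D                     ∎))
  where
  open ≡-Reasoning
  H : ℤ
  H = homogenise cs (↥ x) (↧ x)
  D : ℚ
  D = ι (↧ x)
  D≢0 : D ≢ 0ℚ
  D≢0 ()

no-rational-root : ∀ c cs l → c ≢ 0ℤ → l ≢ 0ℤ → NonzeroOnFractions (c ∷ (cs ∷ʳ l)) ∣ c ∣ ∣ l ∣ →
  ∀ x → eval (c ∷ (cs ∷ʳ l)) x ≢ 0ℚ
no-rational-root c cs l c≢0 l≢0 nonzero x@(mkℚ n dm n⊥d) root =
  nonzero-at {P} nonzero n dm
    (ℕ.∣⇒≤ {{ℤ.≢-nonZero c≢0}} (proj₁ n∣c×d∣l)) (ℕ.∣⇒≤ {{ℤ.≢-nonZero l≢0}} (proj₂ n∣c×d∣l)) H≡0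
  where
  P : List ℤ
  P = c ∷ (cs ∷ʳ l)
  H≡0 : homogenise P n (+ suc dm) ≡ 0ℤ
  H≡0 = root⇒homogenise≡0 P x root
  n∣c×d∣l : (n ∣ c) × (+ suc dm ∣ l)
  n∣c×d∣l = rational-root-theorem {n} {+ suc dm} c cs l (Coprimality.recompute n⊥d) H≡0

X : Expr ℚ 1
X = Ι Fin.zero

⟦eval⟧ : ∀ P x → Ops.⟦ Reified.eval P X ⟧ (x ∷ []) ≡ eval P x
⟦eval⟧ []       x = refl
⟦eval⟧ (c ∷ cs) x = cong (λ e → ι c + x * e) (⟦eval⟧ cs x)

nonvanishing : ∀ c cs l {c≢0 : False (c ℤ.≟ 0ℤ)} {l≢0 : False (l ℤ.≟ 0ℤ)}
  {test : True (nonzeroOnFractions? (c ∷ (cs ∷ʳ l)) ∣ c ∣ ∣ l ∣)} (f : Expr ℚ 1) →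
  (∀ x → Ops.⟦ Reified.eval (c ∷ (cs ∷ʳ l)) X ⇓⟧ (x ∷ []) ≡ Ops.⟦ f ⇓⟧ (x ∷ [])) →
  ∀ x → Ops.⟦ f ⟧ (x ∷ []) ≢ 0ℚ
nonvanishing c cs l {c≢0} {l≢0} {test} f normal-forms x f≡0 =
  no-rational-root c cs l (toWitnessFalse c≢0) (toWitnessFalse l≢0) (toWitness test) x (begin
    eval P x                            ≡⟨ ⟦eval⟧ P x ⟨
    Ops.⟦ Reified.eval P X ⟧ (x ∷ [])
      ≡⟨ Ops.prove (x ∷ []) (Reified.eval P X) f (normal-forms x) ⟩
    Ops.⟦ f ⟧ (x ∷ [])                  ≡⟨ f≡0 ⟩
    0ℚ                                  ∎)
  where
  open ≡-Reasoning
  P : List ℤ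
  P = c ∷ (cs ∷ʳ l)

f₁≢0 : ∀ α → f₁ α ≢ 0ℚ
f₁≢0 = nonvanishing (+ 1) (+ 0 ∷ -[1+ 1 ] ∷ + 0 ∷ []) (+ 5) (Reified.f₁ X) (λ _ → refl)

f₂≢0 : ∀ α → f₂ α ≢ 0ℚ
f₂≢0 = nonvanishing (+ 5) (+ 0 ∷ -[1+ 1 ] ∷ + 0 ∷ []) (+ 1) (Reified.f₂ X) (λ _ → refl)

f₃≢0 : ∀ α → f₃ α ≢ 0ℚ
f₃≢0 = nonvanishing -[1+ 0 ] (+ 2 ∷ []) (+ 1) (Reified.f₃ X) (λ _ → refl)

f₄≢0 : ∀ α → f₄ α ≢ 0ℚ
f₄≢0 = nonvanishing -[1+ 0 ] (-[1+ 1 ] ∷ []) (+ 1) (Reified.f₄ X) (λ _ → refl)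

f₅≢0 : ∀ α → f₅ α ≢ 0ℚ
f₅≢0 = nonvanishing (+ 1) (+ 0 ∷ []) (+ 1) (Reified.f₅ X) (λ _ → refl)

Nc≢0 : ∀ α → Nc α ≢ 0ℚ
Nc≢0 = nonvanishing (+ 1)
  (+ 0 ∷ + 25 ∷ + 0 ∷ + 148 ∷ + 0 ∷ + 1444 ∷ + 0 ∷ -[1+ 337 ] ∷ + 0
     ∷ -[1+ 337 ] ∷ + 0 ∷ + 1444 ∷ + 0 ∷ + 148 ∷ + 0 ∷ + 25 ∷ + 0 ∷ [])
  (+ 1) (Reified.Nc X) (λ _ → refl)

NaD₂²-Nb≢0 : ∀ α → Na α * D₂ α ^ 2 - Nb α ≢ 0ℚ
NaD₂²-Nb≢0 = nonvanishing -[1+ 0 ]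
  (+ 0 ∷ + 137 ∷ + 0 ∷ -[1+ 1443 ] ∷ + 0 ∷ + 2228 ∷ + 0 ∷ -[1+ 3549 ] ∷ + 0
     ∷ + 446 ∷ + 0 ∷ -[1+ 147 ] ∷ + 0 ∷ + 260 ∷ + 0 ∷ + 23 ∷ + 0 ∷ [])
  (+ 1) (Reified.Na X ⊗ Reified.D₂ X ⊙ 2 ⊖ Reified.Nb X) (λ _ → refl)

NaD₂²-Nc≢0 : ∀ α → Na α * D₂ α ^ 2 - Nc α ≢ 0ℚ
NaD₂²-Nc≢0 = nonvanishing -[1+ 81 ]
  (+ 0 ∷ + 704 ∷ + 0 ∷ -[1+ 2631 ] ∷ + 0 ∷ + 2336 ∷ + 0 ∷ -[1+ 1659 ] ∷ + 0
     ∷ -[1+ 255 ] ∷ + 0 ∷ -[1+ 999 ] ∷ + 0 ∷ + 32 ∷ + 0 ∷ [])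
  -[1+ 1 ] (Reified.Na X ⊗ Reified.D₂ X ⊙ 2 ⊖ Reified.Nc X) (λ _ → refl)

Nb-Nc≢0 : ∀ α → Nb α - Nc α ≢ 0ℚ
Nb-Nc≢0 = nonvanishing -[1+ 80 ]
  (+ 0 ∷ + 567 ∷ + 0 ∷ -[1+ 1187 ] ∷ + 0 ∷ + 108 ∷ + 0 ∷ + 1890 ∷ + 0 ∷ -[1+ 701 ] ∷ + 0
     ∷ -[1+ 851 ] ∷ + 0 ∷ -[1+ 227 ] ∷ + 0 ∷ -[1+ 24 ] ∷ + 0 ∷ [])
  -[1+ 0 ] (Reified.Nb X ⊖ Reified.Nc X) (λ _ → refl)

Na*Nb-identity : ∀ α → Na α * Nb α ≡ D₂ α ^ 2 * (D₂ α ^ 4 - D₁ α ^ 4)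
Na*Nb-identity = solve 1 (λ x →
  Reified.Na x ⊗ Reified.Nb x ⊜ Reified.D₂ x ⊙ 2 ⊗ (Reified.D₂ x ⊙ 4 ⊖ Reified.D₁ x ⊙ 4)) refl

Na*Nc-identity : ∀ α → Na α * Nc α ≡ D₂ α ^ 2 * (α ^ 4 * D₂ α ^ 4 - D₁ α ^ 4)
Na*Nc-identity = solve 1 (λ x →
  Reified.Na x ⊗ Reified.Nc x
    ⊜ Reified.D₂ x ⊙ 2 ⊗ (x ⊙ 4 ⊗ Reified.D₂ x ⊙ 4 ⊖ Reified.D₁ x ⊙ 4)) refl

Nb*Nc-identity : ∀ α → Nb α * Nc α + D₁ α ^ 4 * D₂ α ^ 4 ≡ Q α ^ 4
Nb*Nc-identity = solve 1 (λ x →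
  (Reified.Nb x ⊗ Reified.Nc x ⊕ Reified.D₁ x ⊙ 4 ⊗ Reified.D₂ x ⊙ 4) ⊜ Reified.Q x ⊙ 4) refl

module Construction (α : ℚ) (α≢1 : α ≢ 1ℚ) (α≢-1 : α ≢ - 1ℚ) (D₁D₂≢0 : D₁ α * D₂ α ≢ 0ℚ) where
  r s a b c : ℚ
  r = - (D₂ α ⁄ D₁ α)
  s = r * α
  a = Na α ⁄ (D₁ α ^ 2)
  b = Nb α ⁄ ((D₁ α ^ 2) * (D₂ α ^ 2))
  c = Nc α ⁄ ((D₁ α ^ 2) * (D₂ α ^ 2))

  D₁≢0 : D₁ α ≢ 0ℚ
  D₁≢0 D₁≡0 = D₁D₂≢0 (trans (cong (_* D₂ α) D₁≡0) (ℚ.*-zeroˡ (D₂ α)))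

  D₂≢0 : D₂ α ≢ 0ℚ
  D₂≢0 D₂≡0 = D₁D₂≢0 (trans (cong (D₁ α *_) D₂≡0) (ℚ.*-zeroʳ (D₁ α)))

  u v w : ℚ
  u = (1/ D₁ α) {{≢-nonZero D₁≢0}}
  v = (1/ D₂ α) {{≢-nonZero D₂≢0}}
  w = u ^ 2 * v ^ 2

  D₁*u≡1 : D₁ α * u ≡ 1ℚ
  D₁*u≡1 = ℚ.*-inverseʳ (D₁ α) {{≢-nonZero D₁≢0}}

  D₂*v≡1 : D₂ α * v ≡ 1ℚ
  D₂*v≡1 = ℚ.*-inverseʳ (D₂ α) {{≢-nonZero D₂≢0}}

  D₁²*u²≡1 : D₁ α ^ 2 * u ^ 2 ≡ 1ℚ
  D₁²*u²≡1 = inverse-^ 2 {D₁ α} {u} D₁*u≡1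

  D₂²*v²≡1 : D₂ α ^ 2 * v ^ 2 ≡ 1ℚ
  D₂²*v²≡1 = inverse-^ 2 {D₂ α} {v} D₂*v≡1

  L : ℚ
  L = D₁ α ^ 2 * D₂ α ^ 2

  L*w≡1 : L * w ≡ 1ℚ
  L*w≡1 = inverse-* {D₁ α ^ 2} {u ^ 2} {D₂ α ^ 2} {v ^ 2} D₁²*u²≡1 D₂²*v²≡1

  r≡-D₂*u : r ≡ - (D₂ α * u)
  r≡-D₂*u = cong -_ (y*w≡1⇒x⁄y≡x*w {D₂ α} {D₁ α} {u} D₁*u≡1)

  a≡Na*u² : a ≡ Na α * u ^ 2
  a≡Na*u² = y*w≡1⇒x⁄y≡x*w {Na α} {D₁ α ^ 2} {u ^ 2} D₁²*u²≡1

  b≡Nb*w : b ≡ Nb α * w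
  b≡Nb*w = y*w≡1⇒x⁄y≡x*w {Nb α} {L} {w} L*w≡1

  c≡Nc*w : c ≡ Nc α * w
  c≡Nc*w = y*w≡1⇒x⁄y≡x*w {Nc α} {L} {w} L*w≡1

  a≡s²-r² : a ≡ s ^ 2 - r ^ 2
  a≡s²-r² = begin
    a
      ≡⟨ a≡Na*u² ⟩
    Na α * u ^ 2
      ≡⟨ expand (D₂ α) α u ⟩
    (- (D₂ α * u) * α) ^ 2 - (- (D₂ α * u)) ^ 2
      ≡⟨ cong (λ t → (t * α) ^ 2 - t ^ 2) r≡-D₂*u ⟨
    s ^ 2 - r ^ 2 ∎
    where
    open ≡-Reasoning
    expand : ∀ d x u →
      d ^ 2 * (x + 1ℚ) * (x - 1ℚ) * u ^ 2 ≡ (- (d * u) * x) ^ 2 - (- (d * u)) ^ 2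
    expand = solve 3 (λ d x u →
      (d ⊙ 2 ⊗ (x ⊕ Κ 1ℚ) ⊗ (x ⊖ Κ 1ℚ) ⊗ u ⊙ 2)
        ⊜ ((⊝ (d ⊗ u) ⊗ x) ⊙ 2 ⊖ (⊝ (d ⊗ u)) ⊙ 2)) refl

  N*w*[Na*u²]≡Na*N*u⁴v² : ∀ N → N * w * (Na α * u ^ 2) ≡ Na α * N * (u ^ 4 * v ^ 2)
  N*w*[Na*u²]≡Na*N*u⁴v² N = regroup N (Na α) u v
    where
    regroup : ∀ n m u v → n * (u ^ 2 * v ^ 2) * (m * u ^ 2) ≡ m * n * (u ^ 4 * v ^ 2)
    regroup = solve 4 (λ n m u v →
      (n ⊗ (u ⊙ 2 ⊗ v ⊙ 2) ⊗ (m ⊗ u ⊙ 2)) ⊜ (m ⊗ n ⊗ (u ⊙ 4 ⊗ v ⊙ 2))) refl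

  [t⁴-[D₁u]⁴][D₂v]²≡t⁴-1 : ∀ t → (t ^ 4 - (D₁ α * u) ^ 4) * (D₂ α * v) ^ 2 ≡ t ^ 4 - 1ℚ
  [t⁴-[D₁u]⁴][D₂v]²≡t⁴-1 t =
    trans (cong₂ (λ p q → (t ^ 4 - p ^ 4) * q ^ 2) D₁*u≡1 D₂*v≡1) (ℚ.*-identityʳ (t ^ 4 - 1ℚ))

  b*a≡r⁴-1 : b * a ≡ r ^ 4 - 1ℚ
  b*a≡r⁴-1 = begin
    b * a
      ≡⟨ cong₂ _*_ b≡Nb*w a≡Na*u² ⟩
    Nb α * w * (Na α * u ^ 2)
      ≡⟨ N*w*[Na*u²]≡Na*N*u⁴v² (Nb α) ⟩
    Na α * Nb α * (u ^ 4 * v ^ 2)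
      ≡⟨ cong (_* (u ^ 4 * v ^ 2)) (Na*Nb-identity α) ⟩
    D₂ α ^ 2 * (D₂ α ^ 4 - D₁ α ^ 4) * (u ^ 4 * v ^ 2)
      ≡⟨ distribute (D₁ α) (D₂ α) u v ⟩
    ((- (D₂ α * u)) ^ 4 - (D₁ α * u) ^ 4) * (D₂ α * v) ^ 2
      ≡⟨ [t⁴-[D₁u]⁴][D₂v]²≡t⁴-1 (- (D₂ α * u)) ⟩
    (- (D₂ α * u)) ^ 4 - 1ℚ
      ≡⟨ cong (λ t → t ^ 4 - 1ℚ) r≡-D₂*u ⟨
    r ^ 4 - 1ℚ ∎
    where
    open ≡-Reasoning
    distribute : ∀ d₁ d₂ u v →
      d₂ ^ 2 * (d₂ ^ 4 - d₁ ^ 4) * (u ^ 4 * v ^ 2)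
        ≡ ((- (d₂ * u)) ^ 4 - (d₁ * u) ^ 4) * (d₂ * v) ^ 2
    distribute = solve 4 (λ d₁ d₂ u v →
      (d₂ ⊙ 2 ⊗ (d₂ ⊙ 4 ⊖ d₁ ⊙ 4) ⊗ (u ⊙ 4 ⊗ v ⊙ 2))
        ⊜ (((⊝ (d₂ ⊗ u)) ⊙ 4 ⊖ (d₁ ⊗ u) ⊙ 4) ⊗ (d₂ ⊗ v) ⊙ 2)) refl

  c*a≡s⁴-1 : c * a ≡ s ^ 4 - 1ℚ
  c*a≡s⁴-1 = begin
    c * a
      ≡⟨ cong₂ _*_ c≡Nc*w a≡Na*u² ⟩
    Nc α * w * (Na α * u ^ 2)
      ≡⟨ N*w*[Na*u²]≡Na*N*u⁴v² (Nc α) ⟩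
    Na α * Nc α * (u ^ 4 * v ^ 2)
      ≡⟨ cong (_* (u ^ 4 * v ^ 2)) (Na*Nc-identity α) ⟩
    D₂ α ^ 2 * (α ^ 4 * D₂ α ^ 4 - D₁ α ^ 4) * (u ^ 4 * v ^ 2)
      ≡⟨ distribute (D₁ α) (D₂ α) α u v ⟩
    ((- (D₂ α * u) * α) ^ 4 - (D₁ α * u) ^ 4) * (D₂ α * v) ^ 2
      ≡⟨ [t⁴-[D₁u]⁴][D₂v]²≡t⁴-1 (- (D₂ α * u) * α) ⟩
    (- (D₂ α * u) * α) ^ 4 - 1ℚ
      ≡⟨ cong (λ t → (t * α) ^ 4 - 1ℚ) r≡-D₂*u ⟨
    s ^ 4 - 1ℚ ∎
    where
    open ≡-Reasoning
    distribute : ∀ d₁ d₂ x u v →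
      d₂ ^ 2 * (x ^ 4 * d₂ ^ 4 - d₁ ^ 4) * (u ^ 4 * v ^ 2)
        ≡ ((- (d₂ * u) * x) ^ 4 - (d₁ * u) ^ 4) * (d₂ * v) ^ 2
    distribute = solve 5 (λ d₁ d₂ x u v →
      (d₂ ⊙ 2 ⊗ (x ⊙ 4 ⊗ d₂ ⊙ 4 ⊖ d₁ ⊙ 4) ⊗ (u ⊙ 4 ⊗ v ⊙ 2))
        ⊜ (((⊝ (d₂ ⊗ u) ⊗ x) ⊙ 4 ⊖ (d₁ ⊗ u) ⊙ 4) ⊗ (d₂ ⊗ v) ⊙ 2)) refl

  T : ℚ
  T = Q α * (u * v)

  b*c+1≡T⁴ : b * c + 1ℚ ≡ T ^ 4
  b*c+1≡T⁴ = begin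
    b * c + 1ℚ
      ≡⟨ cong₂ (λ p q → p * q + 1ℚ) b≡Nb*w c≡Nc*w ⟩
    Nb α * w * (Nc α * w) + 1ℚ
      ≡⟨ cong (_+_ (Nb α * w * (Nc α * w))) D₁⁴D₂⁴*u⁴v⁴≡1 ⟨
    Nb α * w * (Nc α * w) + D₁ α ^ 4 * D₂ α ^ 4 * (u ^ 4 * v ^ 4)
      ≡⟨ factor (Nb α) (Nc α) (D₁ α) (D₂ α) u v ⟩
    (Nb α * Nc α + D₁ α ^ 4 * D₂ α ^ 4) * (u * v) ^ 4
      ≡⟨ cong (_* (u * v) ^ 4) (Nb*Nc-identity α) ⟩
    Q α ^ 4 * (u * v) ^ 4
      ≡⟨ x⁴y⁴≡[xy]⁴ (Q α) (u * v) ⟩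
    T ^ 4 ∎
    where
    open ≡-Reasoning
    D₁⁴D₂⁴*u⁴v⁴≡1 : D₁ α ^ 4 * D₂ α ^ 4 * (u ^ 4 * v ^ 4) ≡ 1ℚ
    D₁⁴D₂⁴*u⁴v⁴≡1 = inverse-* {D₁ α ^ 4} {u ^ 4} {D₂ α ^ 4} {v ^ 4}
      (inverse-^ 4 {D₁ α} {u} D₁*u≡1) (inverse-^ 4 {D₂ α} {v} D₂*v≡1)
    factor : ∀ n m d₁ d₂ u v →
      n * (u ^ 2 * v ^ 2) * (m * (u ^ 2 * v ^ 2)) + d₁ ^ 4 * d₂ ^ 4 * (u ^ 4 * v ^ 4)
        ≡ (n * m + d₁ ^ 4 * d₂ ^ 4) * (u * v) ^ 4
    factor = solve 6 (λ n m d₁ d₂ u v →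
      (n ⊗ (u ⊙ 2 ⊗ v ⊙ 2) ⊗ (m ⊗ (u ⊙ 2 ⊗ v ⊙ 2)) ⊕ d₁ ⊙ 4 ⊗ d₂ ⊙ 4 ⊗ (u ⊙ 4 ⊗ v ⊙ 4))
        ⊜ ((n ⊗ m ⊕ d₁ ⊙ 4 ⊗ d₂ ⊙ 4) ⊗ (u ⊗ v) ⊙ 4)) refl
    x⁴y⁴≡[xy]⁴ : ∀ x y → x ^ 4 * y ^ 4 ≡ (x * y) ^ 4
    x⁴y⁴≡[xy]⁴ = solve 2 (λ x y → (x ⊙ 4 ⊗ y ⊙ 4) ⊜ (x ⊗ y) ⊙ 4) refl

  a*L≡NaD₂² : a * L ≡ Na α * D₂ α ^ 2
  a*L≡NaD₂² = trans (sym (ℚ.*-assoc a (D₁ α ^ 2) (D₂ α ^ 2)))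
    (cong (_* D₂ α ^ 2) (x⁄z*z≡x (x*y≡1⇒x≢0 {D₁ α ^ 2} {u ^ 2} D₁²*u²≡1) (Na α)))

  b*L≡Nb : b * L ≡ Nb α
  b*L≡Nb = x⁄z*z≡x (x*y≡1⇒x≢0 {L} {w} L*w≡1) (Nb α)

  c*L≡Nc : c * L ≡ Nc α
  c*L≡Nc = x⁄z*z≡x (x*y≡1⇒x≢0 {L} {w} L*w≡1) (Nc α)

  ≢-by-clearing : ∀ {x y X Y} → x * L ≡ X → y * L ≡ Y → X ≢ Y → x ≢ y
  ≢-by-clearing xL≡X yL≡Y X≢Y x≡y = X≢Y (trans (sym xL≡X) (trans (cong (_* L) x≡y) yL≡Y))

  NaD₂²≢0 : Na α * D₂ α ^ 2 ≢ 0ℚ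
  NaD₂²≢0 = *-≢0 (*-≢0 (*-≢0 D₂²≢0 α+1≢0) α-1≢0) D₂²≢0
    where
    open import Algebra.Properties.Group ℚ.+-0-group using (inverseˡ-unique; x∙y⁻¹≈ε⇒x≈y)
    D₂²≢0 : D₂ α ^ 2 ≢ 0ℚ
    D₂²≢0 = x*y≡1⇒x≢0 {D₂ α ^ 2} {v ^ 2} D₂²*v²≡1
    α+1≢0 : α + 1ℚ ≢ 0ℚ
    α+1≢0 α+1≡0 = α≢-1 (inverseˡ-unique α 1ℚ α+1≡0)
    α-1≢0 : α - 1ℚ ≢ 0ℚ
    α-1≢0 α-1≡0 = α≢1 (x∙y⁻¹≈ε⇒x≈y α 1ℚ α-1≡0)

  Nb≢0 : Nb α ≢ 0ℚ
  Nb≢0 =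
    *-≢0 (*-≢0 (*-≢0 (*-≢0 (*-≢0 {x = - k 16} (λ ()) (f₁≢0 α)) (f₂≢0 α)) (f₃≢0 α)) (f₄≢0 α)) (f₅≢0 α)

  a≢0 : a ≢ 0ℚ
  a≢0 = ≢-by-clearing a*L≡NaD₂² (ℚ.*-zeroˡ L) NaD₂²≢0

  b≢0 : b ≢ 0ℚ
  b≢0 = ≢-by-clearing b*L≡Nb (ℚ.*-zeroˡ L) Nb≢0

  c≢0 : c ≢ 0ℚ
  c≢0 = ≢-by-clearing c*L≡Nc (ℚ.*-zeroˡ L) (Nc≢0 α)

  a≢b : a ≢ b
  a≢b = ≢-by-clearing a*L≡NaD₂² b*L≡Nb (x-y≢0⇒x≢y (NaD₂²-Nb≢0 α))

  a≢c : a ≢ c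
  a≢c = ≢-by-clearing a*L≡NaD₂² c*L≡Nc (x-y≢0⇒x≢y (NaD₂²-Nc≢0 α))

  b≢c : b ≢ c
  b≢c = ≢-by-clearing b*L≡Nb c*L≡Nc (x-y≢0⇒x≢y (Nb-Nc≢0 α))

  b≡[r⁴-1]⁄a : b ≡ (r ^ 4 - 1ℚ) ⁄ a
  b≡[r⁴-1]⁄a = sym (x≡y*z⇒x⁄z≡y a≢0 (sym b*a≡r⁴-1))

  c≡[s⁴-1]⁄a : c ≡ (s ^ 4 - 1ℚ) ⁄ a
  c≡[s⁴-1]⁄a = sym (x≡y*z⇒x⁄z≡y a≢0 (sym c*a≡s⁴-1))

  a*b+1≡r⁴ : a * b + 1ℚ ≡ r ^ 4
  a*b+1≡r⁴ = x≡y-1⇒x+1≡y (trans (ℚ.*-comm a b) b*a≡r⁴-1)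

  a*c+1≡s⁴ : a * c + 1ℚ ≡ s ^ 4
  a*c+1≡s⁴ = x≡y-1⇒x+1≡y (trans (ℚ.*-comm a c) c*a≡s⁴-1)

mainTheorem5 : (α : ℚ) → α ≢ 1ℚ → α ≢ - 1ℚ →
    (k 3 * α ^ 4 - k 6 * α ^ 2 - 1ℚ) * (α ^ 4 + k 6 * α ^ 2 - k 3) ≢ 0ℚ →
    let D₁ = k 3 * α ^ 4 - k 6 * α ^ 2 - 1ℚ
        D₂ = α ^ 4 + k 6 * α ^ 2 - k 3
        r = - (D₂ ⁄ D₁)
        s = r * α
        a = ((D₂ ^ 2) * (α + 1ℚ) * (α - 1ℚ)) ⁄ (D₁ ^ 2)
        b = (- k 16 * (k 5 * α ^ 4 - k 2 * α ^ 2 + 1ℚ) * (α ^ 4 - k 2 * α ^ 2 + k 5)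
              * (α ^ 2 + k 2 * α - 1ℚ) * (α ^ 2 - k 2 * α - 1ℚ) * (α ^ 2 + 1ℚ))
            ⁄ ((D₁ ^ 2) * (D₂ ^ 2))
        c = (((α ^ 2 + 1ℚ) ^ 4 + k 16 * α ^ 2 * (α ^ 2 - 1ℚ) ^ 2)
              * ((α - 1ℚ) ^ 4 + k 4 * α ^ 2) * ((α + 1ℚ) ^ 4 + k 4 * α ^ 2) * (α ^ 2 + 1ℚ))
            ⁄ ((D₁ ^ 2) * (D₂ ^ 2))
    in (a ≡ s ^ 2 - r ^ 2) × (b ≡ (r ^ 4 - 1ℚ) ⁄ a) × (c ≡ (s ^ 4 - 1ℚ) ⁄ a)
       × QuarticDiophantineTriple a b c
mainTheorem5 α α≢1 α≢-1 D₁D₂≢0 =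
  a≡s²-r² , b≡[r⁴-1]⁄a , c≡[s⁴-1]⁄a ,
  a≢0 , b≢0 , c≢0 , a≢b , a≢c , b≢c ,
  (r , a*b+1≡r⁴) , (s , a*c+1≡s⁴) , (T , b*c+1≡T⁴)
  where open Construction α α≢1 α≢-1 D₁D₂≢0
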